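{- Let $p$ be a prime, $r\ge1$, and let $L(x)\in\mathbb{F}_{p^r}[x]$ be an additive polynomial and $A(x)\in\mathbb{F}_{p^r}[x]$. Then the following are equivalent: (i) $A(L(x))$ is an Alltop polynomial; (ii) $L(A(x))$ is an Alltop polynomial; (iii) $A(x)$ is an Alltop polynomial and $L(x)$ is a permutation polynomial of $\mathbb{F}_{p^r}$.
   Context: For $f:\mathbb{F}_{p^r}\to\mathbb{F}_{p^r}$ and $a\in\mathbb{F}_{p^r}$ put $\Delta_{f,a}(x)=f(x+a)-f(x)$. A function $f$ is planar if $\Delta_{f,a}$ is a bijection of $\mathbb{F}_{p^r}$ for every $a\in\mathbb{F}_{p^r}^*$. A polynomial $A$ is an Alltop polynomial (Alltop function) if $\Delta_{A,a}$ is planar for every $a\in\mathbb{F}_{p^r}^*$. A polynomial $L$ is additive if $L(x+y)=L(x)+L(y)$ for all $x,y\in\mathbb{F}_{p^r}$. -}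

module Defs where

open import Level using (0ℓ)
open import Data.Nat using (ℕ; _^_)
open import Data.Fin using (Fin)
open import Data.Product using (Σ; _×_)
open import Relation.Nullary using (¬_)
open import Relation.Binary.PropositionalEquality using (_≡_)
open import Algebra.Bundles using (CommutativeRing)
open import Function.Bundles using (_⤖_)
open import Function.Definitions using (Bijective)

-- A finite field with exactly q elements (equality is propositional equality):
-- a commutative ring whose setoid equality coincides with _≡_, with 0 ≠ 1,
-- every nonzero element invertible, and a bijection Fin q ⤖ Carrier.
record FiniteField (q : ℕ) : Set₁ where
  field
    commRing : CommutativeRing 0ℓ 0ℓ
  open CommutativeRing commRing public hiding (ring)
  field
    ≈⇒≡   : ∀ {x y} → x ≈ y → x ≡ y
    0≢1   : ¬ (0# ≡ 1#)
    inv   : ∀ x → ¬ (x ≡ 0#) → Σ Carrier (λ y → x * y ≡ 1#)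
    count : Fin q ⤖ Carrier

𝔽 : ℕ → ℕ → Set₁
𝔽 p r = FiniteField (p ^ r)

module _ {q : ℕ} (F : FiniteField q) where
  open FiniteField F

  Δ : (Carrier → Carrier) → Carrier → Carrier → Carrier
  Δ f a x = f (x + a) - f x

  IsBijection : (Carrier → Carrier) → Set
  IsBijection f = Bijective _≡_ _≡_ f

  Planar : (Carrier → Carrier) → Set
  Planar f = ∀ a → ¬ (a ≡ 0#) → IsBijection (Δ f a)

  Alltop : (Carrier → Carrier) → Set
  Alltop A = ∀ a → ¬ (a ≡ 0#) → Planar (Δ A a)

  Additive : (Carrier → Carrier) → Set
  Additive L = ∀ x y → L (x + y) ≡ L x + L y

  Permutation : (Carrier → Carrier) → Set
  Permutation = IsBijection

-- An additive L is a group endomorphism of (F, +), so second differences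
-- commute with it: Δ_b Δ_a (A ∘ L) = (Δ_{L b} Δ_{L a} A) ∘ L and
-- Δ_b Δ_a (L ∘ A) = L ∘ Δ_b Δ_a A.  If either composite is Alltop, its
-- bijective second difference exhibits L as injective (first case) or
-- surjective (second case); on a finite field both mean L is a permutation,
-- and cancelling the bijection L then shows that A is Alltop.  Conversely,
-- composing with a permutation L preserves bijectivity of all second
-- differences, and L maps nonzero elements to nonzero elements.
module Submission where

open import Data.Nat using (ℕ; _≤_; suc)
open import Data.Nat.Primality using (Prime)
open import Data.Nat.Properties using (1+n≰n)
open import Data.Fin using (Fin; punchOut; _≟_)
open import Data.Fin.Properties using (any?; punchOut-injective; injective⇒≤)
open import Data.Product using (_×_; _,_; proj₁; proj₂)
open import Function using (_∘_)
open import Function.Bundles using (_⇔_; mk⇔; _⤖_; Bijection; Inverse)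
open import Function.Definitions
  using (Injective; Surjective; StrictlySurjective; Bijective)
open import Function.Properties.Bijection using (⤖⇒↔)
open import Function.Consequences using (surjective⇒strictlySurjective)
open import Function.Consequences.Propositional
  using (strictlySurjective⇒surjective)
import Function.Construct.Composition as Compose
open import Relation.Nullary using (yes; no; contradiction)
open import Relation.Binary.PropositionalEquality
  using (_≡_; _≢_; _≗_; refl; sym; trans; cong; cong₂; module ≡-Reasoning)
import Function.Properties.Equivalence as ⇔
import Algebra.Properties.Group as GroupProperties

open import Defs

module _ {A B C : Set} {f : A → B} {g : B → C} where

  bijective-∘⇒injectiveʳ : Bijective _≡_ _≡_ (g ∘ f) → Injective _≡_ _≡_ f
  bijective-∘⇒injectiveʳ (gf-inj , _) fx≡fy = gf-inj (cong g fx≡fy)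

  bijective-∘⇒strictlySurjectiveˡ :
    Bijective _≡_ _≡_ (g ∘ f) → StrictlySurjective _≡_ g
  bijective-∘⇒strictlySurjectiveˡ (_ , gf-surj) z
    with x , gfx≡z ← surjective⇒strictlySurjective _≡_ refl gf-surj z =
    f x , gfx≡z

  bijective-∘-cancelʳ :
    StrictlySurjective _≡_ f → Bijective _≡_ _≡_ (g ∘ f) → Bijective _≡_ _≡_ g
  bijective-∘-cancelʳ f-surj gf-bij@(gf-inj , _) = g-inj , g-surj
    where
    g-inj : Injective _≡_ _≡_ g
    g-inj {y} {y'} gy≡gy'
      with x , fx≡y ← f-surj y | x' , fx'≡y' ← f-surj y' = begin
      y      ≡⟨ sym fx≡y ⟩
      f x    ≡⟨ cong f (gf-inj (trans (cong g fx≡y) (trans gy≡gy' (cong g (sym fx'≡y'))))) ⟩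
      f x'   ≡⟨ fx'≡y' ⟩
      y'     ∎
      where open ≡-Reasoning
    g-surj : Surjective _≡_ _≡_ g
    g-surj = strictlySurjective⇒surjective (bijective-∘⇒strictlySurjectiveˡ gf-bij)

  bijective-∘-cancelˡ :
    Injective _≡_ _≡_ g → Bijective _≡_ _≡_ (g ∘ f) → Bijective _≡_ _≡_ f
  bijective-∘-cancelˡ g-inj gf-bij@(_ , gf-surj) =
    bijective-∘⇒injectiveʳ gf-bij , strictlySurjective⇒surjective f-surj
    where
    f-surj : StrictlySurjective _≡_ f
    f-surj y with x , gfx≡gy ← surjective⇒strictlySurjective _≡_ refl gf-surj (g y) =
      x , g-inj gfx≡gy

bijective-resp-≗ : {A B : Set} {f g : A → B} →
                   f ≗ g → Bijective _≡_ _≡_ f → Bijective _≡_ _≡_ g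
bijective-resp-≗ {f = f} {g} f≗g (f-inj , f-surj) = g-inj , g-surj
  where
  g-inj : Injective _≡_ _≡_ g
  g-inj {x} {y} gx≡gy = f-inj (trans (f≗g x) (trans gx≡gy (sym (f≗g y))))
  g-surj : Surjective _≡_ _≡_ g
  g-surj = strictlySurjective⇒surjective λ z →
    let x , fx≡z = surjective⇒strictlySurjective _≡_ refl f-surj z
    in x , trans (sym (f≗g x)) fx≡z

Fin-injective⇒strictlySurjective : ∀ {n} {f : Fin n → Fin n} →
  Injective _≡_ _≡_ f → StrictlySurjective _≡_ f
Fin-injective⇒strictlySurjective {suc m} {f} f-inj y with any? (λ x → f x ≟ y)
... | yes hit = hit
... | no miss = contradiction (injective⇒≤ squeeze-inj) 1+n≰n
  where
  y≢f : ∀ x → y ≢ f x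
  y≢f x y≡fx = miss (x , sym y≡fx)
  squeeze : Fin (suc m) → Fin m
  squeeze x = punchOut (y≢f x)
  squeeze-inj : Injective _≡_ _≡_ squeeze
  squeeze-inj eq = f-inj (punchOut-injective (y≢f _) (y≢f _) eq)

module _ {C : Set} {n : ℕ} (enumeration : Fin n ⤖ C) where
  private
    open Inverse (⤖⇒↔ enumeration) using (to; from; strictlyInverseˡ)

    from-injective : Injective _≡_ _≡_ from
    from-injective {x} {y} eq =
      trans (sym (strictlyInverseˡ x)) (trans (cong to eq) (strictlyInverseˡ y))

    to-injective : Injective _≡_ _≡_ to
    to-injective = Bijection.injective enumeration

  finite-injective⇒strictlySurjective : {f : C → C} →
    Injective _≡_ _≡_ f → StrictlySurjective _≡_ f
  finite-injective⇒strictlySurjective {f} f-inj y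
    with i , gi≡y ← Fin-injective⇒strictlySurjective {f = from ∘ f ∘ to}
                      (to-injective ∘ f-inj ∘ from-injective) (from y) =
    to i , (begin
      f (to i)               ≡⟨ strictlyInverseˡ _ ⟨
      to (from (f (to i)))   ≡⟨ cong to gi≡y ⟩
      to (from y)            ≡⟨ strictlyInverseˡ y ⟩
      y                      ∎)
    where open ≡-Reasoning

  finite-injective⇒bijective : {f : C → C} → Injective _≡_ _≡_ f → Bijective _≡_ _≡_ f
  finite-injective⇒bijective f-inj =
    f-inj , strictlySurjective⇒surjective (finite-injective⇒strictlySurjective f-inj)

  -- A section s of f is injective, hence onto, so s ∘ f is the identity.
  finite-strictlySurjective⇒injective : {f : C → C} →
    StrictlySurjective _≡_ f → Injective _≡_ _≡_ f
  finite-strictlySurjective⇒injective {f} f-surj {x} {x'} fx≡fx' =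
    trans (section-retracts x) (trans (cong section fx≡fx') (sym (section-retracts x')))
    where
    section : C → C
    section y = proj₁ (f-surj y)
    section-inj : Injective _≡_ _≡_ section
    section-inj {y} {y'} eq =
      trans (sym (proj₂ (f-surj y))) (trans (cong f eq) (proj₂ (f-surj y')))
    section-retracts : ∀ x → x ≡ section (f x)
    section-retracts x with y , sy≡x ← finite-injective⇒strictlySurjective section-inj x =
      trans (sym sy≡x) (cong section (sym (trans (cong f (sym sy≡x)) (proj₂ (f-surj y)))))

  finite-strictlySurjective⇒bijective : {f : C → C} →
    StrictlySurjective _≡_ f → Bijective _≡_ _≡_ f
  finite-strictlySurjective⇒bijective f-surj =
    finite-strictlySurjective⇒injective f-surj , strictlySurjective⇒surjective f-surj

module _ {q : ℕ} (F : FiniteField q) where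
  open FiniteField F
    using (Carrier; _+_; _-_; 0#; 1#; +-group; +-identityʳ; reflexive; ≈⇒≡; 0≢1; count)
  open GroupProperties +-group
    using (identityʳ-unique; //-rightDividesˡ; //-rightDividesʳ)

  1≢0 : 1# ≢ 0#
  1≢0 = 0≢1 ∘ sym

  Δ² : (Carrier → Carrier) → Carrier → Carrier → Carrier → Carrier
  Δ² f a b = Δ F (Δ F f a) b

  Δ-resp-≗ : {f g : Carrier → Carrier} → f ≗ g → ∀ a → Δ F f a ≗ Δ F g a
  Δ-resp-≗ f≗g a x = cong₂ _-_ (f≗g (x + a)) (f≗g x)

  module _ {L : Carrier → Carrier} (L-additive : Additive F L) where

    additive-fixes-0# : L 0# ≡ 0#
    additive-fixes-0# = ≈⇒≡ (identityʳ-unique (L 0#) (L 0#)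
      (reflexive (trans (sym (L-additive 0# 0#)) (cong L (≈⇒≡ (+-identityʳ 0#))))))

    additive-preserves-subtraction : ∀ x y → L (x - y) ≡ L x - L y
    additive-preserves-subtraction x y = begin
      L (x - y)               ≡⟨ ≈⇒≡ (//-rightDividesʳ (L y) (L (x - y))) ⟨
      L (x - y) + L y - L y   ≡⟨ cong (_- L y) (L-additive (x - y) y) ⟨
      L (x - y + y) - L y     ≡⟨ cong (λ z → L z - L y) (≈⇒≡ (//-rightDividesˡ y x)) ⟩
      L x - L y               ∎
      where open ≡-Reasoning

    additive-injective⇒≢0 : Injective _≡_ _≡_ L → ∀ {a} → a ≢ 0# → L a ≢ 0#
    additive-injective⇒≢0 L-inj a≢0 La≡0 = a≢0 (L-inj (trans La≡0 (sym additive-fixes-0#)))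

    Δ-∘-additive : ∀ f a → Δ F (f ∘ L) a ≗ Δ F f (L a) ∘ L
    Δ-∘-additive f a x = cong (λ z → f z - f (L x)) (L-additive x a)

    Δ-additive-∘ : ∀ f a → Δ F (L ∘ f) a ≗ L ∘ Δ F f a
    Δ-additive-∘ f a x = sym (additive-preserves-subtraction (f (x + a)) (f x))

    Δ²-∘-additive : ∀ f a b → Δ² (f ∘ L) a b ≗ Δ² f (L a) (L b) ∘ L
    Δ²-∘-additive f a b x =
      trans (Δ-resp-≗ (Δ-∘-additive f a) b x) (Δ-∘-additive (Δ F f (L a)) b x)

    Δ²-additive-∘ : ∀ f a b → Δ² (L ∘ f) a b ≗ L ∘ Δ² f a b
    Δ²-additive-∘ f a b x =
      trans (Δ-resp-≗ (Δ-additive-∘ f a) b x) (Δ-additive-∘ (Δ F f a) b x)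

    additive-≢0-preimage : ∀ {a} → L a ≢ 0# → a ≢ 0#
    additive-≢0-preimage La≢0 a≡0 = La≢0 (trans (cong L a≡0) additive-fixes-0#)

    module _ {A : Carrier → Carrier} where

      Alltop-∘-additive⇒Permutation : Alltop F (A ∘ L) → Permutation F L
      Alltop-∘-additive⇒Permutation AL-alltop = finite-injective⇒bijective count L-inj
        where
        L-inj : Injective _≡_ _≡_ L
        L-inj = bijective-∘⇒injectiveʳ {f = L} {g = Δ² A (L 1#) (L 1#)}
          (bijective-resp-≗ (Δ²-∘-additive A 1# 1#) (AL-alltop 1# 1≢0 1# 1≢0))

      Alltop-additive-∘⇒Permutation : Alltop F (L ∘ A) → Permutation F L
      Alltop-additive-∘⇒Permutation LA-alltop =
        finite-strictlySurjective⇒bijective count L-surj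
        where
        L-surj : StrictlySurjective _≡_ L
        L-surj = bijective-∘⇒strictlySurjectiveˡ {f = Δ² A 1# 1#} {g = L}
          (bijective-resp-≗ (Δ²-additive-∘ A 1# 1#) (LA-alltop 1# 1≢0 1# 1≢0))

      Alltop-∘-additive⇔ : Alltop F (A ∘ L) ⇔ (Alltop F A × Permutation F L)
      Alltop-∘-additive⇔ = mk⇔ to from
        where
        to : Alltop F (A ∘ L) → Alltop F A × Permutation F L
        to AL-alltop = A-alltop , L-perm
          where
          L-perm = Alltop-∘-additive⇒Permutation AL-alltop
          L-surj = surjective⇒strictlySurjective _≡_ refl (proj₂ L-perm)
          A-alltop : Alltop F A
          A-alltop u u≢0 v v≢0 with a , refl ← L-surj u | b , refl ← L-surj v =
            bijective-∘-cancelʳ L-surj (bijective-resp-≗ (Δ²-∘-additive A a b)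
              (AL-alltop a (additive-≢0-preimage u≢0) b (additive-≢0-preimage v≢0)))
        from : Alltop F A × Permutation F L → Alltop F (A ∘ L)
        from (A-alltop , L-perm@(L-inj , _)) a a≢0 b b≢0 =
          bijective-resp-≗ (sym ∘ Δ²-∘-additive A a b)
            (Compose.bijective _≡_ _≡_ _≡_ L-perm
              (A-alltop (L a) (additive-injective⇒≢0 L-inj a≢0)
                        (L b) (additive-injective⇒≢0 L-inj b≢0)))

      Alltop-additive-∘⇔ : Alltop F (L ∘ A) ⇔ (Alltop F A × Permutation F L)
      Alltop-additive-∘⇔ = mk⇔ to from
        where
        to : Alltop F (L ∘ A) → Alltop F A × Permutation F L
        to LA-alltop = A-alltop , L-perm
          where
          L-perm = Alltop-additive-∘⇒Permutation LA-alltop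
          A-alltop : Alltop F A
          A-alltop a a≢0 b b≢0 = bijective-∘-cancelˡ (proj₁ L-perm)
            (bijective-resp-≗ (Δ²-additive-∘ A a b) (LA-alltop a a≢0 b b≢0))
        from : Alltop F A × Permutation F L → Alltop F (L ∘ A)
        from (A-alltop , L-perm) a a≢0 b b≢0 =
          bijective-resp-≗ (sym ∘ Δ²-additive-∘ A a b)
            (Compose.bijective _≡_ _≡_ _≡_ (A-alltop a a≢0 b b≢0) L-perm)

lemma4 : (p r : ℕ) → Prime p → 1 ≤ r → (F : 𝔽 p r) →
         (L A : FiniteField.Carrier F → FiniteField.Carrier F) → Additive F L →
         (Alltop F (A ∘ L) ⇔ Alltop F (L ∘ A))
         × (Alltop F (L ∘ A) ⇔ (Alltop F A × Permutation F L))
lemma4 _ _ _ _ F L A L-additive =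
  ⇔.trans (Alltop-∘-additive⇔ F L-additive) (⇔.sym (Alltop-additive-∘⇔ F L-additive)) ,
  Alltop-additive-∘⇔ F L-additive
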